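{- For every rational number $t$, define $$a=(t^4-1)(t^4-81),\quad b=4t(t^2-3)(t^4+2t^2+9),\quad c=16t^2(t^4-9),$$ $$d_{ac}=t^8+46t^4+81,\quad d_{bc}=4t(t^2-3)(t^4+10t^2+9),\quad d_s=(t^4-2t^2+9)(t^4+10t^2+9).$$ Then $a^2+c^2=d_{ac}^2$, $b^2+c^2=d_{bc}^2$ and $a^2+b^2+c^2=d_s^2$. Thus these give a nearly-perfect cuboid with edges $a,b,c$ in which all edges, the face diagonals $d_{ac},d_{bc}$ and the space diagonal $d_s$ are rational (only $d_{ab}=\sqrt{a^2+b^2}$ is not guaranteed rational).
   Context: This is the paper's "III parametrization" of nearly-perfect cuboids: cuboids with edges $a,b,c$ where among $a,b,c$, $d_{ab}=\sqrt{a^2+b^2}$, $d_{bc}=\sqrt{b^2+c^2}$, $d_{ac}=\sqrt{a^2+c^2}$, $d_s=\sqrt{a^2+b^2+c^2}$ only the face diagonal $d_{ab}$ may be irrational. -}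

module Defs where

open import Data.Rational using (ℚ; _+_; _*_; _-_; 0ℚ; 1ℚ)
open import Data.Rational.Literals
open import Data.Nat using (ℕ; zero; suc)
import Data.Integer as ℤ

fromℕ : ℕ → ℚ
fromℕ n = ℤ.+ n Data.Rational./ 1

infixr 8 _^_
_^_ : ℚ → ℕ → ℚ
x ^ zero = 1ℚ
x ^ suc n = x * (x ^ n)

edgeA : ℚ → ℚ
edgeA t = (t ^ 4 - 1ℚ) * (t ^ 4 - fromℕ 81)

edgeB : ℚ → ℚ
edgeB t = fromℕ 4 * t * (t ^ 2 - fromℕ 3) * (t ^ 4 + fromℕ 2 * t ^ 2 + fromℕ 9)

edgeC : ℚ → ℚ
edgeC t = fromℕ 16 * t ^ 2 * (t ^ 4 - fromℕ 9)

diagAC : ℚ → ℚ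
diagAC t = t ^ 8 + fromℕ 46 * t ^ 4 + fromℕ 81

diagBC : ℚ → ℚ
diagBC t = fromℕ 4 * t * (t ^ 2 - fromℕ 3) * (t ^ 4 + fromℕ 10 * t ^ 2 + fromℕ 9)

diagS : ℚ → ℚ
diagS t = (t ^ 4 - fromℕ 2 * t ^ 2 + fromℕ 9) * (t ^ 4 + fromℕ 10 * t ^ 2 + fromℕ 9)

{-# OPTIONS --safe #-}
module Submission where

open import Defs
open import Data.Rational using (ℚ; _+_; 1ℚ)
open import Data.Product using (_×_; _,_)
open import Data.Nat using (ℕ)
open import Relation.Binary.PropositionalEquality using (_≡_; refl)
open import Data.Rational.Solver
open +-*-Solver

-- The solver's `p :^ n` unfolds to the same iterated product as `_^_` from Defs,
-- so `⟦ edgeAₚ (var 0) ⟧ (t ∷ [])` is definitionally `edgeA t`, and so on.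

numeral : ∀ {n} → ℕ → Polynomial n
numeral m = con (fromℕ m)

edgeAₚ edgeBₚ edgeCₚ diagACₚ diagBCₚ diagSₚ : ∀ {n} → Polynomial n → Polynomial n
edgeAₚ t = (t :^ 4 :- con 1ℚ) :* (t :^ 4 :- numeral 81)
edgeBₚ t = numeral 4 :* t :* (t :^ 2 :- numeral 3) :* (t :^ 4 :+ numeral 2 :* t :^ 2 :+ numeral 9)
edgeCₚ t = numeral 16 :* t :^ 2 :* (t :^ 4 :- numeral 9)
diagACₚ t = t :^ 8 :+ numeral 46 :* t :^ 4 :+ numeral 81
diagBCₚ t = numeral 4 :* t :* (t :^ 2 :- numeral 3) :* (t :^ 4 :+ numeral 10 :* t :^ 2 :+ numeral 9)
diagSₚ t = (t :^ 4 :- numeral 2 :* t :^ 2 :+ numeral 9) :* (t :^ 4 :+ numeral 10 :* t :^ 2 :+ numeral 9)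

faceAC-pythagorean : (t : ℚ) → edgeA t ^ 2 + edgeC t ^ 2 ≡ diagAC t ^ 2
faceAC-pythagorean = solve 1 (λ t → edgeAₚ t :^ 2 :+ edgeCₚ t :^ 2 := diagACₚ t :^ 2) refl

faceBC-pythagorean : (t : ℚ) → edgeB t ^ 2 + edgeC t ^ 2 ≡ diagBC t ^ 2
faceBC-pythagorean = solve 1 (λ t → edgeBₚ t :^ 2 :+ edgeCₚ t :^ 2 := diagBCₚ t :^ 2) refl

space-pythagorean : (t : ℚ) → edgeA t ^ 2 + edgeB t ^ 2 + edgeC t ^ 2 ≡ diagS t ^ 2
space-pythagorean =
  solve 1 (λ t → edgeAₚ t :^ 2 :+ edgeBₚ t :^ 2 :+ edgeCₚ t :^ 2 := diagSₚ t :^ 2) refl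

mainTheorem5 : (t : ℚ) →
    (edgeA t ^ 2 + edgeC t ^ 2 ≡ diagAC t ^ 2)
    × (edgeB t ^ 2 + edgeC t ^ 2 ≡ diagBC t ^ 2)
    × (edgeA t ^ 2 + edgeB t ^ 2 + edgeC t ^ 2 ≡ diagS t ^ 2)
mainTheorem5 t = faceAC-pythagorean t , faceBC-pythagorean t , space-pythagorean t
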